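{- Let $n\ge 2$ and let $\Omega_n$ be the set of naturally labeled partial orders on $[n]=\{0,1,\dots,n-1\}$. Consider the Markov chain on $\Omega_n$ whose single step (the "relation move") applied to a poset $P\in\Omega_n$ is: choose a pair of elements $x<y$ uniformly at random among the $\binom{n}{2}$ such pairs; if $x\prec y$ is a link of $P$, remove the single relation $x\prec y$; else if $(x,y)$ is a critical pair of $P$, adjoin the single relation $x\prec y$; otherwise leave $P$ unchanged. Then every step produces an element of $\Omega_n$, the chain is ergodic in the sense that for any $A,B\in\Omega_n$ there is a sequence of steps leading from $A$ to $B$ with nonzero probability, and the chain satisfies detailed balance with respect to the uniform distribution on $\Omega_n$, i.e. $\Pr(A\to B)=\Pr(B\to A)$ for all $A,B\in\Omega_n$.
   Context: A poset $(S,\prec)$ here has $\prec$ irreflexive and transitive. A poset on $[n]$ is naturally labeled if $x\prec y$ implies $x<y$ (as integers). $\mathrm{past}(x)=\{z: z\prec x\}$, $\mathrm{fut}(x)=\{z: x\prec z\}$. A link is a relation $x\prec y$ such that there is no $z$ with $x\prec z\prec y$. A critical pair of $P$ is a pair of elements $x<y$ (as integers) with $x\not\prec y$, $\mathrm{past}(x)\subseteq\mathrm{past}(y)$ and $\mathrm{fut}(y)\subseteq\mathrm{fut}(x)$. $\Pr(A\to B)$ denotes the one-step transition probability of the chain from $A$ to $B$. -}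

module Defs where

open import Data.Nat using (ℕ; zero; suc; _≤_; s≤s; z≤n; NonZero; >-nonZero)
open import Data.Nat.Properties using (≤-trans; m≤m+n)
open import Data.Nat.Combinatorics using (_C_; nC1≡n; nCk+nC[k+1]≡[n+1]C[k+1])
open import Data.Bool using (Bool; true; false; _∧_; _∨_; not; if_then_else_)
open import Data.Bool.Properties using () renaming (_≟_ to _≟ᵇ_)
open import Data.Fin using (Fin; _<_; _<?_; toℕ)
open import Data.Nat using (_<ᵇ_)
open import Data.Vec using (Vec; lookup; _[_]≔_; allFin; toList)
open import Data.Vec.Properties using (≡-dec)
open import Data.List using (List; concatMap; filter; length; map)
open import Data.Product using (_×_; _,_; proj₁; proj₂)
open import Data.Integer using (+_)
open import Data.Rational using (ℚ; _/_; 0ℚ) renaming (_<_ to _<ℚ_)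
open import Relation.Binary.PropositionalEquality using (_≡_; subst)
open import Relation.Nullary.Decidable using (does)

-- A (strict) relation on [n] = {0,…,n-1}, encoded as an n×n Boolean matrix:
-- x ≺ y  iff  rel R x y ≡ true.
Rel : ℕ → Set
Rel n = Vec (Vec Bool n) n

rel : ∀ {n} → Rel n → Fin n → Fin n → Bool
rel R x y = lookup (lookup R x) y

IsNatPoset : ∀ {n} → Rel n → Set
IsNatPoset {n} R =
  ((x : Fin n) → rel R x x ≡ false) ×
  ((x y z : Fin n) → rel R x y ≡ true → rel R y z ≡ true → rel R x z ≡ true) ×
  ((x y : Fin n) → rel R x y ≡ true → x < y)

anyF : ∀ {n} → (Fin n → Bool) → Bool
anyF {zero}  f = false
anyF {suc n} f = f Fin.zero ∨ anyF (λ i → f (Fin.suc i))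

allF : ∀ {n} → (Fin n → Bool) → Bool
allF {zero}  f = true
allF {suc n} f = f Fin.zero ∧ allF (λ i → f (Fin.suc i))

_⇒ᵇ_ : Bool → Bool → Bool
a ⇒ᵇ b = not a ∨ b

isLink : ∀ {n} → Rel n → Fin n → Fin n → Bool
isLink R x y = rel R x y ∧ not (anyF (λ z → rel R x z ∧ rel R z y))

isCritical : ∀ {n} → Rel n → Fin n → Fin n → Bool
isCritical R x y =
  (toℕ x <ᵇ toℕ y) ∧ not (rel R x y)
  ∧ allF (λ z → rel R z x ⇒ᵇ rel R z y)
  ∧ allF (λ z → rel R y z ⇒ᵇ rel R x z)

setRel : ∀ {n} → Rel n → Fin n → Fin n → Bool → Rel n
setRel R x y b = R [ x ]≔ (lookup R x [ y ]≔ b)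

step : ∀ {n} → Rel n → Fin n → Fin n → Rel n
step R x y =
  if isLink R x y then setRel R x y false
  else if isCritical R x y then setRel R x y true
  else R

pairs : (n : ℕ) → List (Fin n × Fin n)
pairs n = concatMap (λ x → map (λ y → (x , y)) (filter (λ y → x <? y) (toList (allFin n))))
                    (toList (allFin n))

moveCount : ∀ {n} → Rel n → Rel n → ℕ
moveCount {n} A B =
  length (filter (λ p → ≡-dec (≡-dec _≟ᵇ_) (step A (proj₁ p) (proj₂ p)) B) (pairs n))

nC2-nonZero : ∀ n → 2 ≤ n → NonZero (n C 2)
nC2-nonZero (suc (suc m)) (s≤s (s≤s _)) =
  >-nonZero (≤-trans (s≤s z≤n)
    (subst (λ k → suc m ≤ k) (nCk+nC[k+1]≡[n+1]C[k+1] (suc m) 1)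
      (subst (λ k → suc m ≤ k Data.Nat.+ (suc m C 2)) (Relation.Binary.PropositionalEquality.sym (nC1≡n (suc m)))
        (m≤m+n (suc m) (suc m C 2)))))

Pr : ∀ {n} → 2 ≤ n → Rel n → Rel n → ℚ
Pr {n} h A B = ((+ moveCount A B) / (n C 2)) {{nC2-nonZero n h}}

data Reachable {n : ℕ} (h : 2 ≤ n) : Rel n → Rel n → Set where
  here  : ∀ {A} → Reachable h A A
  there : ∀ {A B C} → 0ℚ <ℚ Pr h A B → Reachable h B C → Reachable h A C

module Submission where

-- Everything rests on one structural fact: a move at (x,y) on a naturally
-- labelled poset A either removes a link x ≺ y, adjoins a critical pair
-- (x,y), or does nothing, and the move at the same pair undoes it:
--   * after removing a link x ≺ y, (x,y) is a critical pair;
--   * after adjoining a critical pair (x,y), x ≺ y is a link.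
-- Both kinds of change preserve irreflexivity, transitivity and natural
-- labelling, which gives closure of Ω_n under moves.  Since a move is an
-- involution, the pairs moving A to B are exactly those moving B to A, so
-- Pr(A → B) = Pr(B → A) (detailed balance).  For ergodicity we connect every
-- poset to the antichain in both directions: a non-empty poset has a link
-- (descend from any relation x ≺ y to a minimal cover above x), removing it
-- lowers the number of relations, and by the involution the removal can be
-- reversed with positive probability as well.

open import Defs
open import Data.Nat using (ℕ; _≤_; _<ᵇ_; suc; z≤n; s≤s; NonZero) renaming (_<_ to _<ℕ_)
open import Data.Nat.Properties using (<⇒<ᵇ; <ᵇ⇒<; m≤n⇒m≤1+n)
open import Data.Nat.Induction using () renaming (<-wellFounded to <ℕ-wellFounded)
open import Data.Nat.Combinatorics using (_C_)
open import Data.Fin using (Fin; _<_; toℕ; _≟_; _<?_)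
open import Data.Fin.Properties using (<⇒≢)
open import Data.Fin.Induction using (<-wellFounded)
open import Data.Product using (_×_; _,_; proj₁; proj₂; ∃)
open import Data.Sum using (_⊎_; inj₁; inj₂)
open import Data.Bool using (Bool; true; false; _∧_; _∨_; not; T)
open import Data.Bool.Properties using (¬-not) renaming (_≟_ to _≟ᵇ_)
open import Data.Empty using (⊥; ⊥-elim)
open import Data.Vec using (Vec; lookup; _[_]≔_; replicate; allFin; toList)
open import Data.Vec.Properties using (≡-dec; lookup∘update; lookup∘update′; []≔-idempotent; []≔-lookup; tabulate∘lookup; tabulate-cong; lookup-replicate)
open import Data.List using (List; []; _∷_; length; filter; map)
open import Data.List.Properties using (filter-≐; filter-some)
open import Data.List.Relation.Unary.All as All using (All)
open import Data.List.Relation.Unary.Any as Any using (Any; here; there)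
open import Data.List.Relation.Unary.Any.Properties using (concat⁺; map⁺)
open import Data.List.Membership.Propositional using (_∈_)
open import Data.List.Membership.Propositional.Properties using (∈-map⁺; ∈-filter⁺)
open import Data.Vec.Membership.Propositional.Properties using (∈-allFin⁺; ∈-toList⁺)
open import Data.Integer using (+_)
open import Data.Rational using (_/_; 0ℚ; normalize) renaming (_<_ to _<ℚ_)
open import Data.Rational.Properties using (positive⁻¹; normalize-pos)
open import Induction.WellFounded using (Acc; acc)
open import Relation.Binary.PropositionalEquality using (_≡_; _≢_; refl; sym; trans; cong; subst; module ≡-Reasoning)
open import Relation.Nullary using (¬_; yes; no; Dec)
open import Relation.Unary using (Decidable)

true≢false : true ≢ false
true≢false ()

∧-true⁻ : ∀ {a b} → a ∧ b ≡ true → a ≡ true × b ≡ true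
∧-true⁻ {true} {true} refl = refl , refl

∧-true⁺ : ∀ {a b} → a ≡ true → b ≡ true → a ∧ b ≡ true
∧-true⁺ refl refl = refl

∨-false⁻ : ∀ {a b} → a ∨ b ≡ false → a ≡ false × b ≡ false
∨-false⁻ {false} {false} refl = refl , refl

not-true⁻ : ∀ {a} → not a ≡ true → a ≡ false
not-true⁻ {false} refl = refl

not-false⁻ : ∀ {a} → not a ≡ false → a ≡ true
not-false⁻ {true} refl = refl

not-true⁺ : ∀ {a} → a ≡ false → not a ≡ true
not-true⁺ refl = refl

⇒ᵇ-elim : ∀ {a b} → a ⇒ᵇ b ≡ true → a ≡ true → b ≡ true
⇒ᵇ-elim {true} {true} _ _ = refl

⇒ᵇ-intro : ∀ {a b} → (a ≡ true → b ≡ true) → a ⇒ᵇ b ≡ true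
⇒ᵇ-intro {false} _ = refl
⇒ᵇ-intro {true} h = h refl

anyF-witness : ∀ {n} (f : Fin n → Bool) → anyF f ≡ true → ∃ λ z → f z ≡ true
anyF-witness {suc n} f eq with f Fin.zero in e
... | true = Fin.zero , e
... | false with anyF-witness (λ i → f (Fin.suc i)) eq
... | z , p = Fin.suc z , p

anyF-false⁻ : ∀ {n} (f : Fin n → Bool) → anyF f ≡ false → ∀ z → f z ≡ false
anyF-false⁻ {suc n} f eq Fin.zero = proj₁ (∨-false⁻ eq)
anyF-false⁻ {suc n} f eq (Fin.suc z) = anyF-false⁻ (λ i → f (Fin.suc i)) (proj₂ (∨-false⁻ eq)) z

anyF-false⁺ : ∀ {n} (f : Fin n → Bool) → (∀ z → f z ≡ false) → anyF f ≡ false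
anyF-false⁺ {ℕ.zero} f h = refl
anyF-false⁺ {suc n} f h rewrite h Fin.zero = anyF-false⁺ (λ i → f (Fin.suc i)) (λ i → h (Fin.suc i))

allF-true⁻ : ∀ {n} (f : Fin n → Bool) → allF f ≡ true → ∀ z → f z ≡ true
allF-true⁻ {suc n} f eq Fin.zero = proj₁ (∧-true⁻ eq)
allF-true⁻ {suc n} f eq (Fin.suc z) = allF-true⁻ (λ i → f (Fin.suc i)) (proj₂ (∧-true⁻ eq)) z

allF-true⁺ : ∀ {n} (f : Fin n → Bool) → (∀ z → f z ≡ true) → allF f ≡ true
allF-true⁺ {ℕ.zero} f h = refl
allF-true⁺ {suc n} f h rewrite h Fin.zero = allF-true⁺ (λ i → f (Fin.suc i)) (λ i → h (Fin.suc i))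

module _ {X : Set} {P Q : X → Set} (P? : Decidable P) (Q? : Decidable Q) where

  filter-length-mono : (l : List X) → All (λ p → P p → Q p) l →
    length (filter P? l) ≤ length (filter Q? l)
  filter-length-mono [] All.[] = z≤n
  filter-length-mono (p ∷ l) (P⇒Q All.∷ rest) with P? p | Q? p
  ... | yes _  | yes _  = s≤s (filter-length-mono l rest)
  ... | yes Pp | no ¬Qp = ⊥-elim (¬Qp (P⇒Q Pp))
  ... | no _   | yes _  = m≤n⇒m≤1+n (filter-length-mono l rest)
  ... | no _   | no _   = filter-length-mono l rest

  filter-length-< : (l : List X) → All (λ p → P p → Q p) l → Any (λ p → Q p × ¬ P p) l →
    length (filter P? l) <ℕ length (filter Q? l)
  filter-length-< (p ∷ l) (P⇒Q All.∷ rest) (here (Qp , ¬Pp)) with P? p | Q? p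
  ... | yes Pp | _      = ⊥-elim (¬Pp Pp)
  ... | no _   | no ¬Qp = ⊥-elim (¬Qp Qp)
  ... | no _   | yes _  = s≤s (filter-length-mono l rest)
  filter-length-< (p ∷ l) (P⇒Q All.∷ rest) (there witness) with P? p | Q? p
  ... | yes _  | yes _  = s≤s (filter-length-< l rest witness)
  ... | yes Pp | no ¬Qp = ⊥-elim (¬Qp (P⇒Q Pp))
  ... | no _   | yes _  = m≤n⇒m≤1+n (filter-length-< l rest witness)
  ... | no _   | no _   = filter-length-< l rest witness

positive-fraction : ∀ k d .{{_ : NonZero d}} → 1 ≤ k → 0ℚ <ℚ ((+ k) / d)
positive-fraction (suc m) d _ = positive⁻¹ (normalize (suc m) d) {{normalize-pos (suc m) d}}

module _ {n : ℕ} where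

  relExt : (A B : Rel n) → (∀ x y → rel A x y ≡ rel B x y) → A ≡ B
  relExt A B same = vecExt A B (λ x → vecExt (lookup A x) (lookup B x) (same x))
    where
      vecExt : ∀ {X : Set} (u v : Vec X n) → (∀ i → lookup u i ≡ lookup v i) → u ≡ v
      vecExt u v pointwise = trans (sym (tabulate∘lookup u))
                                   (trans (tabulate-cong pointwise) (tabulate∘lookup v))

  -- Components of the natural-poset property (the relation is given explicitly,
  -- since it cannot be recovered from the unfolded type IsNatPoset A).
  loop-free : (A : Rel n) → IsNatPoset A → ∀ {x} → ¬ rel A x x ≡ true
  loop-free A (irr , _ , _) {x} r = true≢false (trans (sym r) (irr x))

  transitive : (A : Rel n) → IsNatPoset A → ∀ {x y z} → rel A x y ≡ true → rel A y z ≡ true → rel A x z ≡ true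
  transitive A (_ , tr , _) = tr _ _ _

  natural : (A : Rel n) → IsNatPoset A → ∀ {x y} → rel A x y ≡ true → x < y
  natural A (_ , _ , nat) = nat _ _

  SamePair : Fin n → Fin n → Fin n → Fin n → Set
  SamePair a c x y = a ≡ x × c ≡ y

  samePair? : (a c x y : Fin n) → Dec (SamePair a c x y)
  samePair? a c x y with a ≟ x | c ≟ y
  ... | yes p | yes q = yes (p , q)
  ... | no p  | _     = no (λ r → p (proj₁ r))
  ... | yes _ | no q  = no (λ r → q (proj₂ r))

  rel-setRel-here : (R : Rel n) (x y : Fin n) (b : Bool) → rel (setRel R x y b) x y ≡ b
  rel-setRel-here R x y b rewrite lookup∘update x R (lookup R x [ y ]≔ b) = lookup∘update y (lookup R x) b

  rel-setRel-elsewhere : (R : Rel n) (x y : Fin n) (b : Bool) {a c : Fin n} →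
    ¬ SamePair a c x y → rel (setRel R x y b) a c ≡ rel R a c
  rel-setRel-elsewhere R x y b {a} {c} other with a ≟ x
  ... | yes refl rewrite lookup∘update a R (lookup R a [ y ]≔ b) =
        lookup∘update′ (λ c≡y → other (refl , c≡y)) (lookup R a) b
  ... | no a≢x = cong (λ row → lookup row c) (lookup∘update′ a≢x R (lookup R x [ y ]≔ b))

  setRel-setRel : (R : Rel n) (x y : Fin n) (b c : Bool) → setRel (setRel R x y b) x y c ≡ setRel R x y c
  setRel-setRel R x y b c =
    trans (cong (λ row → (R [ x ]≔ row′) [ x ]≔ (row [ y ]≔ c)) (lookup∘update x R row′))
      (trans (cong (λ row → (R [ x ]≔ row′) [ x ]≔ row) ([]≔-idempotent (lookup R x) y))
        ([]≔-idempotent R x))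
    where
      row′ : Vec Bool n
      row′ = lookup R x [ y ]≔ b

  setRel-unchanged : (R : Rel n) (x y : Fin n) {b : Bool} → rel R x y ≡ b → setRel R x y b ≡ R
  setRel-unchanged R x y refl = trans (cong (R [ x ]≔_) ([]≔-lookup (lookup R x) y)) ([]≔-lookup R x)

  cleared⇒original : (R : Rel n) (x y : Fin n) {a c : Fin n} →
    rel (setRel R x y false) a c ≡ true → rel R a c ≡ true
  cleared⇒original R x y {a} {c} h with samePair? a c x y
  ... | yes (refl , refl) = ⊥-elim (true≢false (trans (sym h) (rel-setRel-here R a c false)))
  ... | no other = trans (sym (rel-setRel-elsewhere R x y false other)) h

  raised⇒original : (R : Rel n) (x y : Fin n) {a c : Fin n} →
    rel (setRel R x y true) a c ≡ true → SamePair a c x y ⊎ rel R a c ≡ true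
  raised⇒original R x y {a} {c} h with samePair? a c x y
  ... | yes same = inj₁ same
  ... | no other = inj₂ (trans (sym (rel-setRel-elsewhere R x y true other)) h)

  original⇒raised : (R : Rel n) (x y : Fin n) {a c : Fin n} →
    rel R a c ≡ true → rel (setRel R x y true) a c ≡ true
  original⇒raised R x y {a} {c} h with samePair? a c x y
  ... | yes (refl , refl) = rel-setRel-here R a c true
  ... | no other = trans (rel-setRel-elsewhere R x y true other) h

  NoMiddle : Rel n → Fin n → Fin n → Set
  NoMiddle R x y = ∀ z → rel R x z ∧ rel R z y ≡ false

  PastIncluded : Rel n → Fin n → Fin n → Set
  PastIncluded R x y = ∀ z → rel R z x ≡ true → rel R z y ≡ true

  FutureIncluded : Rel n → Fin n → Fin n → Set
  FutureIncluded R x y = ∀ z → rel R y z ≡ true → rel R x z ≡ true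

  link⁻ : (R : Rel n) (x y : Fin n) → isLink R x y ≡ true → rel R x y ≡ true × NoMiddle R x y
  link⁻ R x y lk = proj₁ (∧-true⁻ lk) , anyF-false⁻ _ (not-true⁻ (proj₂ (∧-true⁻ lk)))

  link⁺ : (R : Rel n) (x y : Fin n) → rel R x y ≡ true → NoMiddle R x y → isLink R x y ≡ true
  link⁺ R x y r noMid = ∧-true⁺ r (not-true⁺ (anyF-false⁺ _ noMid))

  relatedNonLink-middle : (R : Rel n) (x y : Fin n) → rel R x y ≡ true → isLink R x y ≡ false →
    ∃ λ z → rel R x z ≡ true × rel R z y ≡ true
  relatedNonLink-middle R x y r notLink rewrite r
    with anyF-witness (λ z → rel R x z ∧ rel R z y) (not-false⁻ notLink)
  ... | z , xzy = z , ∧-true⁻ xzy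

  unrelated-notLink : (R : Rel n) (x y : Fin n) → rel R x y ≡ false → isLink R x y ≡ false
  unrelated-notLink R x y r rewrite r = refl

  critical⁻ : (R : Rel n) (x y : Fin n) → isCritical R x y ≡ true →
    x < y × rel R x y ≡ false × PastIncluded R x y × FutureIncluded R x y
  critical⁻ R x y cr with ∧-true⁻ {a = toℕ x <ᵇ toℕ y} cr
  ... | x<ᵇy , rest with ∧-true⁻ rest
  ... | notRel , inclusions with ∧-true⁻ inclusions
  ... | past , fut =
        <ᵇ⇒< (toℕ x) (toℕ y) (subst T (sym x<ᵇy) _) , not-true⁻ notRel
        , (λ z → ⇒ᵇ-elim (allF-true⁻ _ past z)) , (λ z → ⇒ᵇ-elim (allF-true⁻ _ fut z))

  critical⁺ : (R : Rel n) (x y : Fin n) → x < y → rel R x y ≡ false →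
    PastIncluded R x y → FutureIncluded R x y → isCritical R x y ≡ true
  critical⁺ R x y x<y notRel past fut =
    ∧-true⁺ (T⇒true (<⇒<ᵇ x<y)) (∧-true⁺ (not-true⁺ notRel)
      (∧-true⁺ (allF-true⁺ _ (λ z → ⇒ᵇ-intro (past z))) (allF-true⁺ _ (λ z → ⇒ᵇ-intro (fut z)))))
    where
      T⇒true : ∀ {b} → T b → b ≡ true
      T⇒true {true} _ = refl

  data MoveShape (R : Rel n) (x y : Fin n) : Rel n → Set where
    removal  : isLink R x y ≡ true → MoveShape R x y (setRel R x y false)
    addition : isLink R x y ≡ false → isCritical R x y ≡ true → MoveShape R x y (setRel R x y true)
    idle     : isLink R x y ≡ false → isCritical R x y ≡ false → MoveShape R x y R

  moveShape : (R : Rel n) (x y : Fin n) → MoveShape R x y (step R x y)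
  moveShape R x y with isLink R x y in lk
  ... | true = removal lk
  ... | false with isCritical R x y in cr
  ... | true  = addition lk cr
  ... | false = idle lk cr

  step-removal : (R : Rel n) (x y : Fin n) → isLink R x y ≡ true → step R x y ≡ setRel R x y false
  step-removal R x y lk rewrite lk = refl

  step-addition : (R : Rel n) (x y : Fin n) → isLink R x y ≡ false → isCritical R x y ≡ true →
    step R x y ≡ setRel R x y true
  step-addition R x y lk cr rewrite lk | cr = refl

  step-idle : (R : Rel n) (x y : Fin n) → isLink R x y ≡ false → isCritical R x y ≡ false → step R x y ≡ R
  step-idle R x y lk cr rewrite lk | cr = refl

  -- Removing a link keeps transitivity: a composite a ≺ b ≺ c landing on the
  -- removed pair would be a middle element of the link.
  removeLink-isNatPoset : (A : Rel n) (x y : Fin n) → IsNatPoset A → isLink A x y ≡ true →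
    IsNatPoset (setRel A x y false)
  removeLink-isNatPoset A x y P lk = irr′ , tr′ , nat′
    where
      A′ : Rel n
      A′ = setRel A x y false
      irr′ : ∀ a → rel A′ a a ≡ false
      irr′ a = ¬-not (λ h → loop-free A P (cleared⇒original A x y h))
      tr′ : ∀ a b c → rel A′ a b ≡ true → rel A′ b c ≡ true → rel A′ a c ≡ true
      tr′ a b c ab bc with samePair? a c x y
      ... | yes (refl , refl) = ⊥-elim (true≢false (trans
              (sym (∧-true⁺ (cleared⇒original A a c ab) (cleared⇒original A a c bc)))
              (proj₂ (link⁻ A x y lk) b)))
      ... | no other = trans (rel-setRel-elsewhere A x y false other)
              (transitive A P (cleared⇒original A x y ab) (cleared⇒original A x y bc))
      nat′ : ∀ a c → rel A′ a c ≡ true → a < c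
      nat′ a c h = natural A P (cleared⇒original A x y h)

  -- Adding a critical pair keeps transitivity: composites through the new
  -- relation x ≺ y exist already, by the inclusions of past and future.
  addCritical-isNatPoset : (A : Rel n) (x y : Fin n) → IsNatPoset A → isCritical A x y ≡ true →
    IsNatPoset (setRel A x y true)
  addCritical-isNatPoset A x y P cr = irr′ , tr′ , nat′
    where
      x<y : x < y
      x<y = proj₁ (critical⁻ A x y cr)
      past : PastIncluded A x y
      past = proj₁ (proj₂ (proj₂ (critical⁻ A x y cr)))
      fut : FutureIncluded A x y
      fut = proj₂ (proj₂ (proj₂ (critical⁻ A x y cr)))
      A′ : Rel n
      A′ = setRel A x y true
      irr′ : ∀ a → rel A′ a a ≡ false
      irr′ a = ¬-not (λ h → loop (raised⇒original A x y h))
        where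
          loop : SamePair a a x y ⊎ rel A a a ≡ true → ⊥
          loop (inj₁ (refl , refl)) = <⇒≢ x<y refl
          loop (inj₂ r) = loop-free A P r
      tr′ : ∀ a b c → rel A′ a b ≡ true → rel A′ b c ≡ true → rel A′ a c ≡ true
      tr′ a b c ab bc with raised⇒original A x y ab | raised⇒original A x y bc
      ... | inj₁ (refl , refl) | inj₁ (b≡a , _) = ⊥-elim (<⇒≢ x<y (sym b≡a))
      ... | inj₁ (refl , refl) | inj₂ r = original⇒raised A a b (fut c r)
      ... | inj₂ r | inj₁ (refl , refl) = original⇒raised A b c (past a r)
      ... | inj₂ r₁ | inj₂ r₂ = original⇒raised A x y (transitive A P r₁ r₂)
      nat′ : ∀ a c → rel A′ a c ≡ true → a < c
      nat′ a c h with raised⇒original A x y h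
      ... | inj₁ (refl , refl) = x<y
      ... | inj₂ r = natural A P r

  step-isNatPoset : (A : Rel n) → IsNatPoset A → (x y : Fin n) → IsNatPoset (step A x y)
  step-isNatPoset A P x y with step A x y | moveShape A x y
  ... | _ | removal lk    = removeLink-isNatPoset A x y P lk
  ... | _ | addition _ cr = addCritical-isNatPoset A x y P cr
  ... | _ | idle _ _      = P

  -- After removing a link x ≺ y, the pair (x,y) is critical: everything below x
  -- is still below y, and everything above y still above x, by transitivity
  -- through the removed relation (none of these composites is the pair itself).
  removedLink-critical : (A : Rel n) (x y : Fin n) → IsNatPoset A → isLink A x y ≡ true →
    isCritical (setRel A x y false) x y ≡ true
  removedLink-critical A x y P lk =
    critical⁺ A′ x y (natural A P xy) (rel-setRel-here A x y false) past fut
    where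
      xy : rel A x y ≡ true
      xy = proj₁ (link⁻ A x y lk)
      A′ : Rel n
      A′ = setRel A x y false
      past : PastIncluded A′ x y
      past z zx = trans (rel-setRel-elsewhere A x y false (λ { (refl , _) → loop-free A P zx′ }))
                        (transitive A P zx′ xy)
        where
          zx′ : rel A z x ≡ true
          zx′ = cleared⇒original A x y zx
      fut : FutureIncluded A′ x y
      fut z yz = trans (rel-setRel-elsewhere A x y false (λ { (_ , refl) → loop-free A P yz′ }))
                       (transitive A P xy yz′)
        where
          yz′ : rel A y z ≡ true
          yz′ = cleared⇒original A x y yz

  -- After adjoining a critical pair (x,y), x ≺ y is a link: a middle element z
  -- would give x ⪯ z ⪯ y in A with x ⊀ y, contradicting transitivity or x < y.
  addedCritical-link : (A : Rel n) (x y : Fin n) → IsNatPoset A → isCritical A x y ≡ true →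
    isLink (setRel A x y true) x y ≡ true
  addedCritical-link A x y P cr = link⁺ (setRel A x y true) x y (rel-setRel-here A x y true) noMiddle
    where
      x<y : x < y
      x<y = proj₁ (critical⁻ A x y cr)
      notXY : rel A x y ≡ false
      notXY = proj₁ (proj₂ (critical⁻ A x y cr))
      middle : ∀ {z} → SamePair x z x y ⊎ rel A x z ≡ true → SamePair z y x y ⊎ rel A z y ≡ true → ⊥
      middle (inj₁ (_ , refl)) (inj₁ (y≡x , _)) = <⇒≢ x<y (sym y≡x)
      middle (inj₁ (_ , refl)) (inj₂ r)         = loop-free A P r
      middle (inj₂ r) (inj₁ (refl , _))         = loop-free A P r
      middle (inj₂ r₁) (inj₂ r₂)                = true≢false (trans (sym (transitive A P r₁ r₂)) notXY)
      noMiddle : NoMiddle (setRel A x y true) x y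
      noMiddle z = ¬-not (λ h → middle (raised⇒original A x y (proj₁ (∧-true⁻ h)))
                                       (raised⇒original A x y (proj₂ (∧-true⁻ h))))

  step-involutive : (A : Rel n) → IsNatPoset A → (x y : Fin n) → step (step A x y) x y ≡ A
  step-involutive A P x y with step A x y | moveShape A x y
  ... | _ | removal lk = begin
        step (setRel A x y false) x y
          ≡⟨ step-addition (setRel A x y false) x y
               (unrelated-notLink (setRel A x y false) x y (rel-setRel-here A x y false))
               (removedLink-critical A x y P lk) ⟩
        setRel (setRel A x y false) x y true
          ≡⟨ setRel-setRel A x y false true ⟩
        setRel A x y true
          ≡⟨ setRel-unchanged A x y (proj₁ (link⁻ A x y lk)) ⟩
        A ∎
    where open ≡-Reasoning
  ... | _ | addition _ cr = begin
        step (setRel A x y true) x y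
          ≡⟨ step-removal (setRel A x y true) x y (addedCritical-link A x y P cr) ⟩
        setRel (setRel A x y true) x y false
          ≡⟨ setRel-setRel A x y true false ⟩
        setRel A x y false
          ≡⟨ setRel-unchanged A x y (proj₁ (proj₂ (critical⁻ A x y cr))) ⟩
        A ∎
    where open ≡-Reasoning
  ... | _ | idle lk cr = step-idle A x y lk cr

  moveCount-sym : (A B : Rel n) → IsNatPoset A → IsNatPoset B → moveCount A B ≡ moveCount B A
  moveCount-sym A B PA PB = cong length (filter-≐ _ _ (forth , back) (pairs n))
    where
      forth : ∀ {p} → step A (proj₁ p) (proj₂ p) ≡ B → step B (proj₁ p) (proj₂ p) ≡ A
      forth {x , y} refl = step-involutive A PA x y
      back : ∀ {p} → step B (proj₁ p) (proj₂ p) ≡ A → step A (proj₁ p) (proj₂ p) ≡ B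
      back {x , y} refl = step-involutive B PB x y

  ∈-pairs : {x y : Fin n} → x < y → (x , y) ∈ pairs n
  ∈-pairs {x} {y} x<y = concat⁺ (map⁺ (Any.map (λ { refl → row }) (∈-toList⁺ (∈-allFin⁺ x))))
    where
      row : (x , y) ∈ map (λ y′ → (x , y′)) (filter (λ y′ → x <? y′) (toList (allFin n)))
      row = ∈-map⁺ (λ y′ → (x , y′)) (∈-filter⁺ (λ y′ → x <? y′) (∈-toList⁺ (∈-allFin⁺ y)) x<y)

  relationCount : Rel n → ℕ
  relationCount R = length (filter (λ p → rel R (proj₁ p) (proj₂ p) ≟ᵇ true) (pairs n))

  antichain : Rel n
  antichain = replicate n (replicate n false)

  unrelated⇒antichain : (A : Rel n) → (∀ x y → rel A x y ≡ false) → A ≡ antichain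
  unrelated⇒antichain A none = relExt A antichain (λ x y → trans (none x y) (sym (empty x y)))
    where
      empty : ∀ x y → rel antichain x y ≡ false
      empty x y rewrite lookup-replicate x (replicate n false) = lookup-replicate y false

  unrelated-or-related : (A : Rel n) → (∀ x y → rel A x y ≡ false) ⊎ (∃ λ x → ∃ λ y → rel A x y ≡ true)
  unrelated-or-related A with anyF (λ x → anyF (λ y → rel A x y)) in related
  ... | false = inj₁ (λ x y → anyF-false⁻ (λ y → rel A x y) (anyF-false⁻ (λ x → anyF (λ y → rel A x y)) related x) y)
  ... | true with anyF-witness (λ x → anyF (λ y → rel A x y)) related
  ... | x , rowRelated with anyF-witness (λ y → rel A x y) rowRelated
  ... | y , xy = inj₂ (x , y , xy)

  -- Every relation x ≺ y has a link x ≺ z above x: descend to a middle element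
  -- while there is one (well-founded, since the middle element is smaller than y).
  linkAbove : (A : Rel n) → IsNatPoset A → {x y : Fin n} → rel A x y ≡ true → ∃ λ z → isLink A x z ≡ true
  linkAbove A P {x} r = descend r (<-wellFounded _)
    where
      descend : ∀ {y} → rel A x y ≡ true → Acc _<_ y → ∃ λ z → isLink A x z ≡ true
      descend {y} xy (acc smaller) with isLink A x y in lk
      ... | true = y , lk
      ... | false with relatedNonLink-middle A x y xy lk
      ... | z , xz , zy = descend xz (smaller (natural A P zy))

  relationCount-removal : (A : Rel n) {x y : Fin n} → x < y → rel A x y ≡ true →
    relationCount (setRel A x y false) <ℕ relationCount A
  relationCount-removal A {x} {y} x<y r =
    filter-length-< _ _ (pairs n) (All.tabulate (λ _ → cleared⇒original A x y))
      (Any.map (λ { refl → r , (λ e → true≢false (trans (sym e) (rel-setRel-here A x y false))) }) (∈-pairs x<y))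

module _ {n : ℕ} (h : 2 ≤ n) where

  Pr-sym : (A B : Rel n) → IsNatPoset A → IsNatPoset B → Pr h A B ≡ Pr h B A
  Pr-sym A B PA PB = cong (λ k → ((+ k) / (n C 2)) {{nC2-nonZero n h}}) (moveCount-sym A B PA PB)

  move-positive : (A : Rel n) {x y : Fin n} → x < y → 0ℚ <ℚ Pr h A (step A x y)
  move-positive A {x} {y} x<y = positive-fraction _ (n C 2) {{nC2-nonZero n h}}
    (filter-some (λ p → ≡-dec (≡-dec _≟ᵇ_) (step A (proj₁ p) (proj₂ p)) (step A x y))
      (Any.map (λ { refl → refl }) (∈-pairs x<y)))

  move-positive-both : (A : Rel n) → IsNatPoset A → {x y : Fin n} → x < y →
    0ℚ <ℚ Pr h A (step A x y) × 0ℚ <ℚ Pr h (step A x y) A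
  move-positive-both A P {x} {y} x<y =
    move-positive A x<y , subst (λ B → 0ℚ <ℚ Pr h (step A x y) B) (step-involutive A P x y) (move-positive (step A x y) x<y)

  _▷_ : {A B C : Rel n} → Reachable h A B → 0ℚ <ℚ Pr h B C → Reachable h A C
  here ▷ p = there p here
  there q r ▷ p = there q (r ▷ p)

  _⨾_ : {A B C : Rel n} → Reachable h A B → Reachable h B C → Reachable h A C
  here ⨾ r = r
  there q r ⨾ s = there q (r ⨾ s)

  antichain-connected : (A : Rel n) → IsNatPoset A →
    Reachable h A antichain × Reachable h antichain A
  antichain-connected A₀ P₀ = go A₀ P₀ (<ℕ-wellFounded (relationCount A₀))
    where
      go : (A : Rel n) → IsNatPoset A → Acc _<ℕ_ (relationCount A) →
        Reachable h A antichain × Reachable h antichain A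
      go A P (acc smaller) with unrelated-or-related A
      ... | inj₁ none = subst (λ X → Reachable h X antichain × Reachable h antichain X)
              (sym (unrelated⇒antichain A none)) (here , here)
      ... | inj₂ (x , _ , xy) with linkAbove A P xy
      ... | z , lk = there forth (proj₁ viaSmaller) , (proj₂ viaSmaller ▷ back)
        where
          x<z : x < z
          x<z = natural A P (proj₁ (link⁻ A x z lk))
          forth : 0ℚ <ℚ Pr h A (step A x z)
          forth = proj₁ (move-positive-both A P x<z)
          back : 0ℚ <ℚ Pr h (step A x z) A
          back = proj₂ (move-positive-both A P x<z)
          fewer : relationCount (step A x z) <ℕ relationCount A
          fewer = subst (λ B → relationCount B <ℕ relationCount A) (sym (step-removal A x z lk))
                    (relationCount-removal A x<z (proj₁ (link⁻ A x z lk)))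
          viaSmaller : Reachable h (step A x z) antichain × Reachable h antichain (step A x z)
          viaSmaller = go (step A x z) (step-isNatPoset A P x z) (smaller fewer)

  reachable : (A B : Rel n) → IsNatPoset A → IsNatPoset B → Reachable h A B
  reachable A B PA PB = proj₁ (antichain-connected A PA) ⨾ proj₂ (antichain-connected B PB)

mainTheorem1 : (n : ℕ) → (h : 2 ≤ n) →
    ((A : Rel n) → IsNatPoset A → (x y : Fin n) → x < y → IsNatPoset (step A x y))
    × ((A B : Rel n) → IsNatPoset A → IsNatPoset B → Reachable h A B)
    × ((A B : Rel n) → IsNatPoset A → IsNatPoset B → Pr h A B ≡ Pr h B A)
mainTheorem1 n h =
  (λ A P x y _ → step-isNatPoset A P x y) ,
  reachable h ,
  Pr-sym h
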